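{- Let $q$ be a prime power, let $n\in\mathbb{N}$ and let $S\subseteq\{0,1,\ldots,n\}$ be non-empty. If $q=2$, assume that $n\notin S$ and $S\neq\{0,1,\ldots,n-1\}$. If $q=3$, assume $S\neq\{0,n\}$. Then $\delta_S$ has maximum least period $q^n-1$.
   Context: Let $p$ be the characteristic of $\mathbb{F}_q$. Define $\Omega(0)=\{0\}\subseteq\mathbb{Z}_{q^n-1}$ and for $1\le w\le n$, $\Omega(w)$ is the set of $k\in\mathbb{Z}_{q^n-1}$ whose canonical representative in $\{0,\ldots,q^n-2\}$ equals $q^{i_1}+\cdots+q^{i_w}$ for some $0\le i_1<\cdots<i_w\le n-1$ (i.e. has exactly $w$ nonzero base-$q$ digits, all equal to $1$). For $S\subseteq[0,n]$, $\delta_S:\mathbb{Z}_{q^n-1}\to\mathbb{F}_p$ is the indicator function of $\bigcup_{w\in S}\Omega(w)$. A function $f$ on $\mathbb{Z}_N$ is $r$-periodic if $f(i)=f(i+\bar r)$ for all $i\in\mathbb{Z}_N$; its least period is the smallest such positive integer $r$, and it has maximum least period if this equals $N$. -}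

module Defs where

open import Data.Nat using (ℕ; zero; suc; _+_; _*_; _∸_; _^_; _<_)
open import Data.Nat.DivMod using (_%_)
open import Data.Nat.Primality using (Prime)
open import Data.Bool using (if_then_else_)
open import Data.Fin using (Fin; toℕ)
open import Data.Fin.Subset using (Subset; _∈_; ∣_∣)
open import Data.List using (map; allFin)
open import Data.Nat.ListAction using (sum)
open import Data.Vec using (lookup)
open import Data.Product using (Σ; _×_)
open import Relation.Nullary using (¬_)
open import Relation.Binary.PropositionalEquality using (_≡_)
open import Function.Bundles using (_⇔_)

IsPrimePower : ℕ → Set
IsPrimePower q = Σ ℕ λ p → Σ ℕ λ k → Prime p × (0 < k) × (q ≡ p ^ k)

digitSum : (q n : ℕ) → Subset n → ℕ
digitSum q n I = sum (map (λ i → if lookup I i then q ^ toℕ i else 0) (allFin n))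

-- k ∈ Ω(w), where k is the canonical representative in {0,…,q^n-2}:
-- k = q^{i_1}+…+q^{i_w} for some distinct indices in {0,…,n-1}.
-- (For w = 0 this gives Ω(0) = {0}.)
Ω : (q n w k : ℕ) → Set
Ω q n w k = Σ (Subset n) λ I → (∣ I ∣ ≡ w) × (k ≡ digitSum q n I)

-- δ_S(k) = 1 iff k ∈ ⋃_{w ∈ S} Ω(w); represented as the proposition "δ_S(k) = 1"
-- (S ⊆ {0,…,n} is a subset of Fin (suc n)).
δ : (q n : ℕ) → Subset (suc n) → ℕ → Set
δ q n S k = Σ (Fin (suc n)) λ w → (w ∈ S) × Ω q n (toℕ w) k

-- reduction mod N (only used with N ≥ 1)
_mod_ : ℕ → ℕ → ℕ
a mod zero = a
a mod suc m = a % suc m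

-- r-periodicity of a 0/1-valued function f on ℤ_N (elements = residues 0..N-1):
-- f(i) = f(i + r) for all i, i.e. f(i) = 1 ⇔ f(i + r mod N) = 1.
Periodic : (N : ℕ) → (ℕ → Set) → ℕ → Set
Periodic N f r = ∀ i → i < N → f i ⇔ f ((i + r) mod N)

LeastPeriod : (N : ℕ) → (ℕ → Set) → ℕ → Set
LeastPeriod N f r = (0 < r) × Periodic N f r × (∀ r′ → 0 < r′ → r′ < r → ¬ Periodic N f r′)

MaxLeastPeriod : (N : ℕ) → (ℕ → Set) → Set
MaxLeastPeriod N f = LeastPeriod N f N

-- Residues modulo N = q ^ n - 1 are base-q words of length n, and δ S is the
-- indicator of the 0/1 words whose weight lies in S. Suppose 0 < r < N is a period.
--
-- For q ≥ 3 take a 0/1 word A in the support. The expansions X, Y of a + r and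
-- a - r are 0/1 words too, and X + Y ≡ A + A (mod N) with all digits at most 2 < q.
-- Uniqueness of digits forces X = A, impossible, unless the congruence is the
-- wrap-around 0 ≡ N; that needs q = 3 and A = 0…0 or 1…1, so S = {0, n}.
--
-- For q = 2 the period r is a non-constant 0/1 word R, and N - r is its complement.
-- Adding r to a word disjoint from R raises the weight by |R|; adding it to a word
-- holding only the lower bit of an adjacent pair 1, 0 of R instead carries that bit,
-- turning weight t + 1 into t + |R|. Together with shifts by the complement this links
-- all weights below n, so S ∩ [0, n) is empty or everything.

module Submission where

open import Defs
open import Data.Bool using (true; false; if_then_else_)
open import Data.Empty using (⊥; ⊥-elim)
open import Data.Fin as Fin using (Fin; toℕ; fromℕ)
open import Data.Fin.Properties using (toℕ-injective; toℕ≤pred[n]; toℕ-fromℕ)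
open import Data.Fin.Subset using (Subset; _∈_; _∉_; ∣_∣; Nonempty)
import Data.List as List using (tabulate)
open import Data.List.Properties using (map-tabulate; tabulate-cong)
open import Data.Nat using (ℕ; zero; suc; _+_; _*_; _∸_; _^_; _≤_; _<_; z≤n; s≤s; s≤s⁻¹; NonZero; >-nonZero; nonTrivial⇒n>1)
open import Data.Nat.Divisibility using (divides; ∣⇒≤)
open import Data.Nat.DivMod
  using (_%_; _/_; m<n⇒m%n≡m; [m+kn]%n≡m%n; [m+n]%n≡m%n; m≡m%n+[m/n]*n; m%n<n; m%n%n≡m%n; n%n≡0; %-distribˡ-+; m<n*o⇒m/o<n)
import Data.Nat.ListAction as List
open import Data.Nat.Primality using (prime⇒nonTrivial)
open import Data.Nat.Properties
open import Data.Nat.Tactic.RingSolver using (solve-∀)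
open import Data.Product using (Σ; ∃; ∃₂; _×_; _,_; proj₁; proj₂)
open import Data.Sum as Sum using (_⊎_; inj₁; inj₂)
open import Data.Vec using (Vec; []; _∷_; head; tail; zipWith; replicate; map; sum; lookup)
open import Data.Vec.Properties using (zipWith-identityˡ; zipWith-replicate)
open import Data.Vec.Relation.Unary.All as All using (All; []; _∷_)
open import Function.Base using (id; _∘_)
open import Function.Bundles using (_⇔_; mk⇔; Equivalence)
open import Function.Properties.Equivalence using (⇔-isEquivalence; ⇔-setoid)
open import Level using (0ℓ)
open import Relation.Binary.PropositionalEquality
open import Relation.Binary.Structures using (IsEquivalence)
open import Relation.Nullary using (¬_)

private
  module ⇔ = IsEquivalence (⇔-isEquivalence {ℓ = 0ℓ})

private variable
  n : ℕ

infixl 6 _⊕_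

_⊕_ : Vec ℕ n → Vec ℕ n → Vec ℕ n
_⊕_ = zipWith _+_

value : ℕ → Vec ℕ n → ℕ
value q []       = 0
value q (d ∷ ds) = d + q * value q ds

value-⊕ : ∀ q (c d : Vec ℕ n) → value q (c ⊕ d) ≡ value q c + value q d
value-⊕ q []       []       = refl
value-⊕ q (x ∷ c) (y ∷ d) rewrite value-⊕ q c d = lemma x y q (value q c) (value q d)
  where
  lemma : ∀ x y q u v → x + y + q * (u + v) ≡ x + q * u + (y + q * v)
  lemma = solve-∀

value-zeros : ∀ q n → value q (replicate n 0) ≡ 0
value-zeros q zero    = refl
value-zeros q (suc n) rewrite value-zeros q n = *-zeroʳ q

digit-uniqueness : ∀ {q a b x y} → a < q → b < q → a + q * x ≡ b + q * y → a ≡ b × x ≡ y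
digit-uniqueness {q@(suc _)} {a} {b} {x} {y} a<q b<q eq = a≡b , x≡y
  where
  low : ∀ {d} z → d < q → (d + q * z) % q ≡ d
  low {d} z d<q = trans (cong (λ w → (d + w) % q) (*-comm q z))
                        (trans ([m+kn]%n≡m%n d z q) (m<n⇒m%n≡m d<q))
  a≡b : a ≡ b
  a≡b = trans (sym (low x a<q)) (trans (cong (_% q) eq) (low y b<q))
  x≡y : x ≡ y
  x≡y = *-cancelˡ-≡ x y q (+-cancelˡ-≡ a _ _ (trans eq (cong (_+ q * y) (sym a≡b))))

value-injective : ∀ {q} {c d : Vec ℕ n} → All (_< q) c → All (_< q) d → value q c ≡ value q d → c ≡ d
value-injective []         []         _  = refl
value-injective (a<q ∷ as) (b<q ∷ bs) eq with digit-uniqueness a<q b<q eq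
... | refl , tail-eq = cong (_ ∷_) (value-injective as bs tail-eq)

value<q^n : ∀ {q} {c : Vec ℕ n} → All (_< q) c → value q c < q ^ n
value<q^n []                    = s≤s z≤n
value<q^n {suc n} {q} {d ∷ c} (d<q ∷ ds) = begin
  suc d + q * value q c   ≤⟨ +-monoˡ-≤ _ d<q ⟩
  q + q * value q c       ≡⟨ sym (*-suc q (value q c)) ⟩
  q * suc (value q c)     ≤⟨ *-monoʳ-≤ q (value<q^n ds) ⟩
  q * q ^ n               ∎
  where open ≤-Reasoning

suc-value-max : ∀ q n → 1 ≤ q → suc (value q (replicate n (q ∸ 1))) ≡ q ^ n
suc-value-max q zero    _   = refl
suc-value-max q (suc n) 1≤q = begin
  suc (q ∸ 1) + q * v   ≡⟨ cong (_+ q * v) (trans (+-comm 1 (q ∸ 1)) (m∸n+n≡m 1≤q)) ⟩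
  q + q * v             ≡⟨ sym (*-suc q v) ⟩
  q * suc v             ≡⟨ cong (q *_) (suc-value-max q n 1≤q) ⟩
  q * q ^ n             ∎
  where
  open ≡-Reasoning
  v = value q (replicate n (q ∸ 1))

sum-⊕ : (c d : Vec ℕ n) → sum (c ⊕ d) ≡ sum c + sum d
sum-⊕ []      []      = refl
sum-⊕ (x ∷ c) (y ∷ d) rewrite sum-⊕ c d = lemma x y (sum c) (sum d)
  where
  lemma : ∀ x y u v → x + y + (u + v) ≡ x + u + (y + v)
  lemma = solve-∀

Binary : Vec ℕ n → Set
Binary = All (_≤ 1)

binary⇒sum≤length : {c : Vec ℕ n} → Binary c → sum c ≤ n
binary⇒sum≤length []       = z≤n
binary⇒sum≤length (d≤1 ∷ ds) = +-mono-≤ d≤1 (binary⇒sum≤length ds)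

binary-split : (a b c : Vec ℕ n) → Binary (a ⊕ (b ⊕ c)) → Binary (a ⊕ b) × Binary (a ⊕ c)
binary-split []      []      []      []       = [] , []
binary-split (x ∷ a) (y ∷ b) (z ∷ c) (p ∷ ps) =
  ≤-trans (+-monoʳ-≤ x (m≤m+n y z)) p ∷ proj₁ rest , ≤-trans (+-monoʳ-≤ x (m≤n+m z y)) p ∷ proj₂ rest
  where rest = binary-split a b c ps

binary-⊕ˡ : (a b : Vec ℕ n) → Binary (a ⊕ b) → Binary a
binary-⊕ˡ []      []      []       = []
binary-⊕ˡ (x ∷ a) (y ∷ b) (p ∷ ps) = ≤-trans (m≤m+n x y) p ∷ binary-⊕ˡ a b ps

all-replicate : ∀ {P : ℕ → Set} {k} n → P k → All P (replicate n k)
all-replicate zero    _  = []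
all-replicate (suc n) pk = pk ∷ all-replicate n pk

sum-replicate : ∀ n k → sum (replicate n k) ≡ n * k
sum-replicate zero    k = refl
sum-replicate (suc n) k = cong (k +_) (sum-replicate n k)

sum-zeros : {c : Vec ℕ n} → c ≡ replicate n 0 → sum c ≡ 0
sum-zeros {n} refl = trans (sum-replicate n 0) (*-zeroʳ n)

sum-ones : {c : Vec ℕ n} → c ≡ replicate n 1 → sum c ≡ n
sum-ones {n} refl = trans (sum-replicate n 1) (*-identityʳ n)

binary-⊕≤2 : {c d : Vec ℕ n} → Binary c → Binary d → All (_≤ 2) (c ⊕ d)
binary-⊕≤2 []         []         = []
binary-⊕≤2 (x≤1 ∷ bc) (y≤1 ∷ bd) = +-mono-≤ x≤1 y≤1 ∷ binary-⊕≤2 bc bd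

constant-bound : ∀ {b k} {c : Vec ℕ n} → 1 ≤ n → All (_≤ b) c → c ≡ replicate n k → k ≤ b
constant-bound (s≤s z≤n) (k≤b ∷ _) refl = k≤b

binary-midpoint : {X Y A : Vec ℕ n} → Binary X → Binary Y → Binary A → X ⊕ Y ≡ A ⊕ A → X ≡ A
binary-midpoint []         []         []         _  = refl
binary-midpoint (x≤1 ∷ bX) (y≤1 ∷ bY) (a≤1 ∷ bA) eq =
  cong₂ _∷_ (digit x≤1 y≤1 a≤1 (cong head eq)) (binary-midpoint bX bY bA (cong tail eq))
  where
  digit : ∀ {x y a} → x ≤ 1 → y ≤ 1 → a ≤ 1 → x + y ≡ a + a → x ≡ a
  digit z≤n       z≤n       z≤n       _  = refl
  digit z≤n       z≤n       (s≤s z≤n) ()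
  digit z≤n       (s≤s z≤n) z≤n       ()
  digit z≤n       (s≤s z≤n) (s≤s z≤n) ()
  digit (s≤s z≤n) z≤n       z≤n       ()
  digit (s≤s z≤n) z≤n       (s≤s z≤n) ()
  digit (s≤s z≤n) (s≤s z≤n) z≤n       ()
  digit (s≤s z≤n) (s≤s z≤n) (s≤s z≤n) _  = refl

binary-of-weight : ∀ n t → t ≤ n → Σ (Vec ℕ n) λ c → Binary c × sum c ≡ t
binary-of-weight zero    zero    z≤n       = [] , [] , refl
binary-of-weight (suc n) zero    z≤n       with binary-of-weight n zero z≤n
... | c , bc , sc = 0 ∷ c , z≤n ∷ bc , sc
binary-of-weight (suc n) (suc t) (s≤s t≤n) with binary-of-weight n t t≤n
... | c , bc , sc = 1 ∷ c , s≤s z≤n ∷ bc , cong suc sc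

-- Binary (B ⊕ R) says that the words B and R have disjoint supports.
choose-disjoint : ∀ {R : Vec ℕ n} t → Binary R → t + sum R ≤ n
                → Σ (Vec ℕ n) λ B → Binary (B ⊕ R) × sum B ≡ t
choose-disjoint {R = []} zero [] _ = [] , [] , refl
choose-disjoint {suc n} {1 ∷ R} t (s≤s z≤n ∷ bR) le
  with choose-disjoint t bR (s≤s⁻¹ (subst (_≤ suc n) (+-suc t (sum R)) le))
... | B , bBR , refl = 0 ∷ B , s≤s z≤n ∷ bBR , refl
choose-disjoint {R = 0 ∷ R} zero (z≤n ∷ bR) _ with choose-disjoint zero bR (binary⇒sum≤length bR)
... | B , bBR , sB = 0 ∷ B , z≤n ∷ bBR , sB
choose-disjoint {R = 0 ∷ R} (suc t) (z≤n ∷ bR) (s≤s le) with choose-disjoint t bR le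
... | B , bBR , refl = 1 ∷ B , s≤s z≤n ∷ bBR , refl

binary-expansion : ∀ n r → r < 2 ^ n → Σ (Vec ℕ n) λ R → Binary R × value 2 R ≡ r
binary-expansion zero    zero    _   = [] , [] , refl
binary-expansion zero    (suc r) (s≤s ())
binary-expansion (suc n) r       r<  with binary-expansion n (r / 2) (m<n*o⇒m/o<n (subst (r <_) (*-comm 2 (2 ^ n)) r<))
... | R , bR , vR = r % 2 ∷ R , s≤s⁻¹ (m%n<n r 2) ∷ bR , (begin
  r % 2 + 2 * value 2 R   ≡⟨ cong (λ v → r % 2 + 2 * v) vR ⟩
  r % 2 + 2 * (r / 2)     ≡⟨ cong (r % 2 +_) (*-comm 2 (r / 2)) ⟩
  r % 2 + r / 2 * 2       ≡⟨ sym (m≡m%n+[m/n]*n r 2) ⟩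
  r                       ∎)
  where open ≡-Reasoning

complement : Vec ℕ n → Vec ℕ n
complement = map (1 ∸_)

binary-⊕-complement : {R : Vec ℕ n} → Binary R → R ⊕ complement R ≡ replicate n 1
binary-⊕-complement []         = refl
binary-⊕-complement (d≤1 ∷ ds) = cong₂ _∷_ (m+[n∸m]≡n d≤1) (binary-⊕-complement ds)

complement-weight : {R : Vec ℕ n} → Binary R → sum R + sum (complement R) ≡ n
complement-weight {R = R} bR = trans (sym (sum-⊕ R (complement R))) (sum-ones (binary-⊕-complement bR))

binary-complement : (R : Vec ℕ n) → Binary (complement R)
binary-complement []      = []
binary-complement (d ∷ R) = m∸n≤m 1 d ∷ binary-complement R

-- Carry E R R′: R has digits 1, 0 at some positions j, j + 1, E is the unit
-- word at j and R′ is R with that 1 moved to j + 1; in base 2, E + R = R′.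
data Carry : Vec ℕ n → Vec ℕ n → Vec ℕ n → Set where
  here  : {R : Vec ℕ n} → Carry (1 ∷ 0 ∷ replicate n 0) (1 ∷ 0 ∷ R) (0 ∷ 1 ∷ R)
  there : ∀ {d} {E R R′ : Vec ℕ n} → Carry E R R′ → Carry (0 ∷ E) (d ∷ R) (d ∷ R′)

HasCarry : Vec ℕ n → Set
HasCarry R = ∃₂ λ E R′ → Carry E R R′

carry-value : {E R R′ : Vec ℕ n} → Carry E R R′ → value 2 E + value 2 R ≡ value 2 R′
carry-value {suc (suc n)} {R = 1 ∷ 0 ∷ R} here rewrite value-zeros 2 n = lemma (value 2 R)
  where
  lemma : ∀ v → 1 + 2 * (0 + 2 * 0) + (1 + 2 * (0 + 2 * v)) ≡ 0 + 2 * (1 + 2 * v)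
  lemma = solve-∀
carry-value {R = d ∷ R} {d ∷ R′} (there {E = E} c) = begin
  0 + 2 * value 2 E + (d + 2 * value 2 R)   ≡⟨ lemma d (value 2 E) (value 2 R) ⟩
  d + 2 * (value 2 E + value 2 R)           ≡⟨ cong (λ v → d + 2 * v) (carry-value c) ⟩
  d + 2 * value 2 R′                        ∎
  where
  open ≡-Reasoning
  lemma : ∀ d e v → 0 + 2 * e + (d + 2 * v) ≡ d + 2 * (e + v)
  lemma = solve-∀

carry-unit : {E R R′ : Vec ℕ n} → Carry E R R′ → sum E ≡ 1
carry-unit (here {n}) = cong suc (sum-zeros {n} refl)
carry-unit (there c)  = carry-unit c

carry-sum : {E R R′ : Vec ℕ n} → Carry E R R′ → sum R′ ≡ sum R
carry-sum here                = refl
carry-sum (there {d = d} c) = cong (d +_) (carry-sum c)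

carry-binary : {E R R′ : Vec ℕ n} → Binary R → Carry E R R′ → Binary (E ⊕ R′)
carry-binary (_ ∷ _ ∷ bR) (here {R = R}) =
  ≤-refl ∷ ≤-refl ∷ subst Binary (sym (zipWith-identityˡ +-identityˡ R)) bR
carry-binary (d≤1 ∷ bR) (there c) = d≤1 ∷ carry-binary bR c

-- An adjacent pair 0, 1 in R is a pair 1, 0 in its complement.
constant-or-carry : {R : Vec ℕ n} → Binary R
                  → (∃ λ d → R ≡ replicate n d) ⊎ HasCarry R ⊎ HasCarry (complement R)
constant-or-carry []               = inj₁ (0 , refl)
constant-or-carry (_ ∷ [])         = inj₁ (_ , refl)
constant-or-carry (d≤1 ∷ e≤1 ∷ bR) with constant-or-carry (e≤1 ∷ bR)
... | inj₂ (inj₁ (E , R′ , c))     = inj₂ (inj₁ (0 ∷ E , _ , there c))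
... | inj₂ (inj₂ (E , R′ , c))     = inj₂ (inj₂ (0 ∷ E , _ , there c))
constant-or-carry (z≤n     ∷ z≤n     ∷ bR) | inj₁ (_ , refl) = inj₁ (0 , refl)
constant-or-carry (s≤s z≤n ∷ s≤s z≤n ∷ bR) | inj₁ (_ , refl) = inj₁ (1 , refl)
constant-or-carry (s≤s z≤n ∷ z≤n     ∷ bR) | inj₁ (_ , refl) = inj₂ (inj₁ (_ , _ , here))
constant-or-carry (z≤n     ∷ s≤s z≤n ∷ bR) | inj₁ (_ , refl) = inj₂ (inj₂ (_ , _ , here))

module _ {M : ℕ} (f : ℕ → Set) where

  private N = suc M

  periodic-self : Periodic N f N
  periodic-self i i<N = ⇔.reflexive (cong f (sym (trans ([m+n]%n≡m%n i N) (m<n⇒m%n≡m i<N))))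

  periodic-∸ : ∀ {r} → r ≤ N → Periodic N f r → Periodic N f (N ∸ r)
  periodic-∸ {r} r≤N per i i<N = ⇔.trans (⇔.reflexive (cong f (sym back))) (⇔.sym (per j (m%n<n (i + (N ∸ r)) N)))
    where
    j = (i + (N ∸ r)) % N
    back : (j + r) % N ≡ i
    back = begin
      (j + r) % N                 ≡⟨ %-distribˡ-+ j r N ⟩
      (j % N + r % N) % N         ≡⟨ cong (λ w → (w + r % N) % N) (m%n%n≡m%n (i + (N ∸ r)) N) ⟩
      (j + r % N) % N             ≡⟨ sym (%-distribˡ-+ (i + (N ∸ r)) r N) ⟩
      (i + (N ∸ r) + r) % N       ≡⟨ cong (_% N) (trans (+-assoc i (N ∸ r) r) (cong (i +_) (m∸n+n≡m r≤N))) ⟩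
      (i + N) % N                 ≡⟨ [m+n]%n≡m%n i N ⟩
      i % N                       ≡⟨ m<n⇒m%n≡m i<N ⟩
      i                           ∎
      where open ≡-Reasoning

  periodic-step : ∀ {r a} → Periodic N f r → a + r < N → f a ⇔ f (a + r)
  periodic-step {r} {a} per a+r<N =
    ⇔.trans (per a (≤-<-trans (m≤m+n a r) a+r<N)) (⇔.reflexive (cong f (m<n⇒m%n≡m a+r<N)))

module _ {N : ℕ} .{{_ : NonZero N}} where

  %-no-fixed-point : ∀ {a r} → 0 < r → r < N → (a + r) % N ≢ a
  %-no-fixed-point {a} {r} 0<r r<N eq = <⇒≱ r<N (∣⇒≤ {{>-nonZero 0<r}} (divides ((a + r) / N) r≡kN))
    where
    r≡kN : r ≡ (a + r) / N * N
    r≡kN = +-cancelˡ-≡ a r _ (trans (m≡m%n+[m/n]*n (a + r) N) (cong (_+ (a + r) / N * N) eq))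

  %-≤-cases : ∀ {a b} → a ≤ N → b ≤ N → a % N ≡ b % N
            → a ≡ b ⊎ (a ≡ 0 × b ≡ N) ⊎ (a ≡ N × b ≡ 0)
  %-≤-cases a≤N b≤N eq with m≤n⇒m<n∨m≡n a≤N | m≤n⇒m<n∨m≡n b≤N
  ... | inj₁ a<N | inj₁ b<N = inj₁ (trans (sym (m<n⇒m%n≡m a<N)) (trans eq (m<n⇒m%n≡m b<N)))
  ... | inj₁ a<N | inj₂ refl = inj₂ (inj₁ (trans (sym (m<n⇒m%n≡m a<N)) (trans eq (n%n≡0 N)) , refl))
  ... | inj₂ refl | inj₁ b<N = inj₂ (inj₂ (refl , trans (sym (m<n⇒m%n≡m b<N)) (trans (sym eq) (n%n≡0 N))))
  ... | inj₂ refl | inj₂ refl = inj₁ refl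

  %-opposite-shifts : ∀ a {r} → r ≤ N → ((a + r) % N + (a + (N ∸ r)) % N) % N ≡ (a + a) % N
  %-opposite-shifts a {r} r≤N = begin
    ((a + r) % N + (a + (N ∸ r)) % N) % N   ≡⟨ sym (%-distribˡ-+ (a + r) (a + (N ∸ r)) N) ⟩
    (a + r + (a + (N ∸ r))) % N             ≡⟨ cong (_% N) (lemma a r (N ∸ r)) ⟩
    (a + a + (r + (N ∸ r))) % N             ≡⟨ cong (λ w → (a + a + w) % N) (m+[n∸m]≡n r≤N) ⟩
    (a + a + N) % N                         ≡⟨ [m+n]%n≡m%n (a + a) N ⟩
    (a + a) % N                             ∎
    where
    open ≡-Reasoning
    lemma : ∀ a r s → a + r + (a + s) ≡ a + a + (r + s)
    lemma = solve-∀

constant-below : (P : ℕ → Set) {n d : ℕ} → 0 < d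
               → (∀ t → t < d → P t ⇔ P (suc t))
               → (∀ t → t + d < n → P t ⇔ P (t + d))
               → ∀ v → v < n → P v ⇔ P 0
constant-below P {n} {d} 0<d step shift v v<n = begin
  P v                     ≡⟨ cong P (m≡m%n+[m/n]*n v d) ⟩
  P (v % d + v / d * d)   ≈⟨ jumps (v / d) (v % d) (subst (_< n) (m≡m%n+[m/n]*n v d) v<n) ⟨
  P (v % d)               ≈⟨ climb (v % d) (<⇒≤ (m%n<n v d)) ⟩
  P 0                     ∎
  where
  open import Relation.Binary.Reasoning.Setoid (⇔-setoid 0ℓ)
  instance
    _ : NonZero d
    _ = >-nonZero 0<d
  climb : ∀ t → t ≤ d → P t ⇔ P 0
  climb zero    _    = ⇔.refl
  climb (suc t) t<d = ⇔.trans (⇔.sym (step t t<d)) (climb t (<⇒≤ t<d))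
  jumps : ∀ m t → t + m * d < n → P t ⇔ P (t + m * d)
  jumps zero    t _  = ⇔.reflexive (cong P (sym (+-identityʳ t)))
  jumps (suc m) t lt = ⇔.trans (jumps m t (≤-<-trans (+-monoʳ-≤ t (m≤n+m (m * d) d)) lt))
                               (⇔.trans (shift (t + m * d) (subst (_< n) (reassoc t m) lt))
                                        (⇔.reflexive (cong P (sym (reassoc t m)))))
    where
    reassoc : ∀ t m → t + (d + m * d) ≡ t + m * d + d
    reassoc t m = trans (cong (t +_) (+-comm d (m * d))) (sym (+-assoc t (m * d) d))

word : Subset n → Vec ℕ n
word = map (λ b → if b then 1 else 0)

binary-word : (I : Subset n) → Binary (word I)
binary-word []          = []
binary-word (true ∷ I)  = ≤-refl ∷ binary-word I
binary-word (false ∷ I) = z≤n ∷ binary-word I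

binary⇒word : {c : Vec ℕ n} → Binary c → Σ (Subset n) λ I → word I ≡ c
binary⇒word []             = [] , refl
binary⇒word (z≤n     ∷ bc) = let I , eq = binary⇒word bc in false ∷ I , cong (0 ∷_) eq
binary⇒word (s≤s z≤n ∷ bc) = let I , eq = binary⇒word bc in true ∷ I , cong (1 ∷_) eq

∣∣≡sum-word : (I : Subset n) → ∣ I ∣ ≡ sum (word I)
∣∣≡sum-word []          = refl
∣∣≡sum-word (true ∷ I)  = cong suc (∣∣≡sum-word I)
∣∣≡sum-word (false ∷ I) = ∣∣≡sum-word I

digitSum≡value : ∀ q n (I : Subset n) → digitSum q n I ≡ value q (word I)
digitSum≡value q n I = trans (cong List.sum (map-tabulate id (term I))) (tabulated I)
  where
  term : ∀ {n} → Subset n → Fin n → ℕ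
  term I i = if lookup I i then q ^ toℕ i else 0
  sum-scale : ∀ {n} (F : Fin n → ℕ) → List.sum (List.tabulate (λ i → q * F i)) ≡ q * List.sum (List.tabulate F)
  sum-scale {zero}  F = sym (*-zeroʳ q)
  sum-scale {suc n} F = trans (cong (q * F Fin.zero +_) (sum-scale (F ∘ Fin.suc))) (sym (*-distribˡ-+ q (F Fin.zero) _))
  if-scale : ∀ b x → (if b then q * x else 0) ≡ q * (if b then x else 0)
  if-scale true  x = refl
  if-scale false x = sym (*-zeroʳ q)
  tabulated : ∀ {n} (I : Subset n) → List.sum (List.tabulate (term I)) ≡ value q (word I)
  tabulated []      = refl
  tabulated (b ∷ I) = cong₂ _+_ (if-one b) (begin
    List.sum (List.tabulate (λ i → term (b ∷ I) (Fin.suc i)))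
      ≡⟨ cong List.sum (tabulate-cong (λ i → if-scale (lookup I i) (q ^ toℕ i))) ⟩
    List.sum (List.tabulate (λ i → q * term I i))              ≡⟨ sum-scale (term I) ⟩
    q * List.sum (List.tabulate (term I))                      ≡⟨ cong (q *_) (tabulated I) ⟩
    q * value q (word I)                                       ∎)
    where
    open ≡-Reasoning
    if-one : ∀ b → (if b then q ^ 0 else 0) ≡ (if b then 1 else 0)
    if-one true  = refl
    if-one false = refl

_∈ʷ_ : ∀ {n} → ℕ → Subset (suc n) → Set
v ∈ʷ S = ∃ λ w → toℕ w ≡ v × w ∈ S

toℕ∈ʷ⇔∈ : ∀ {n} {S : Subset (suc n)} (w : Fin (suc n)) → toℕ w ∈ʷ S ⇔ w ∈ S
toℕ∈ʷ⇔∈ w = mk⇔ (λ (w′ , eq , w′∈S) → subst (_∈ _) (toℕ-injective eq) w′∈S)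
                (λ w∈S → w , refl , w∈S)

module Support {q n : ℕ} (2≤q : 2 ≤ q) (S : Subset (suc n)) where

  binary⇒digits<q : {c : Vec ℕ n} → Binary c → All (_< q) c
  binary⇒digits<q = All.map (λ d≤1 → ≤-trans (s≤s d≤1) 2≤q)

  δ-binary : {c : Vec ℕ n} → Binary c → δ q n S (value q c) ⇔ sum c ∈ʷ S
  δ-binary {c} bc = mk⇔ to from
    where
    to : δ q n S (value q c) → sum c ∈ʷ S
    to (w , w∈S , I , ∣I∣≡w , v≡) =
      w , trans (sym ∣I∣≡w) (trans (∣∣≡sum-word I) (cong sum word≡c)) , w∈S
      where
      word≡c : word I ≡ c
      word≡c = value-injective (binary⇒digits<q (binary-word I)) (binary⇒digits<q bc)
                 (trans (sym (digitSum≡value q n I)) (sym v≡))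
    from : sum c ∈ʷ S → δ q n S (value q c)
    from (w , w≡ , w∈S) with binary⇒word bc
    ... | I , refl = w , w∈S , I , trans (∣∣≡sum-word I) (sym w≡) , sym (digitSum≡value q n I)

  δ⇒binary : ∀ {x} → δ q n S x → Σ (Vec ℕ n) λ c → Binary c × value q c ≡ x
  δ⇒binary (_ , _ , I , _ , x≡) = word I , binary-word I , trans (sym (digitSum≡value q n I)) (sym x≡)

pred≤2⇒≡3 : ∀ {q} → 3 ≤ q → q ∸ 1 ≤ 2 → q ≡ 3
pred≤2⇒≡3 (s≤s (s≤s (s≤s z≤n))) (s≤s (s≤s z≤n)) = refl

module Periodicity (q n M : ℕ) (2≤q : 2 ≤ q) (S : Subset (suc n))
                   (value-max : value q (replicate n (q ∸ 1)) ≡ suc M) where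

  open Support 2≤q S

  private
    1≤q : 1 ≤ q
    1≤q = ≤-trans (s≤s z≤n) 2≤q

  N : ℕ
  N = suc M

  f : ℕ → Set
  f = δ q n S

  max-digits : All (_< q) (replicate n (q ∸ 1))
  max-digits = all-replicate n (∸-monoʳ-< {o = 0} (s≤s z≤n) 1≤q)

  value≤N : {c : Vec ℕ n} → All (_< q) c → value q c ≤ N
  value≤N {c} c<q =
    s≤s⁻¹ (subst (value q c <_) (trans (sym (suc-value-max q n 1≤q)) (cong suc value-max)) (value<q^n c<q))

  value≡N⇒max : {c : Vec ℕ n} → All (_< q) c → value q c ≡ N → c ≡ replicate n (q ∸ 1)
  value≡N⇒max c<q eq = value-injective c<q max-digits (trans eq (sym value-max))

  value<N : {c : Vec ℕ n} → All (_< q) c → c ≢ replicate n (q ∸ 1) → value q c < N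
  value<N c<q c≢max with m≤n⇒m<n∨m≡n (value≤N c<q)
  ... | inj₁ lt = lt
  ... | inj₂ eq = ⊥-elim (c≢max (value≡N⇒max c<q eq))

  -- X and Y are the expansions of a + r and a − r (mod N), both in the support of f.
  shifted-pair : ∀ {r a} → Periodic N f r → r < N → a < N → f a
               → ∃₂ λ X Y → Binary X × Binary Y × f (value q X) × value q X ≡ (a + r) % N
                            × (value q X + value q Y) % N ≡ (a + a) % N
  shifted-pair {r} {a} per r<N a<N fa =
    let X , bX , vX = δ⇒binary fx
        Y , bY , vY = δ⇒binary fy
    in X , Y , bX , bY , subst f (sym vX) fx , vX ,
       trans (cong₂ (λ u v → (u + v) % N) vX vY) (%-opposite-shifts a (<⇒≤ r<N))
    where
    fx = Equivalence.to (per a a<N) fa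
    fy = Equivalence.to (periodic-∸ f (<⇒≤ r<N) per a a<N) fa

  module _ (3≤q : 3 ≤ q) (1≤n : 1 ≤ n) where

    binary-⊕<q : {c d : Vec ℕ n} → Binary c → Binary d → All (_< q) (c ⊕ d)
    binary-⊕<q bc bd = All.map (λ le → ≤-trans (s≤s le) 3≤q) (binary-⊕≤2 bc bd)

    binary-⊕-value≡0 : {c d : Vec ℕ n} → Binary c → Binary d → value q (c ⊕ d) ≡ 0 → c ≡ replicate n 0
    binary-⊕-value≡0 bc bd eq = binary-midpoint bc bd (all-replicate n z≤n) (begin
      _ ⊕ _                                 ≡⟨ value-injective (binary-⊕<q bc bd) (all-replicate n 1≤q)
                                                 (trans eq (sym (value-zeros q n))) ⟩
      replicate n 0                         ≡⟨ sym (zipWith-replicate _+_ 0 0) ⟩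
      replicate n 0 ⊕ replicate n 0         ∎)
      where open ≡-Reasoning

    -- The digits of c ⊕ d are at most 2, so they can only all equal q ∸ 1 when q = 3.
    binary-⊕-value≡N : {c d : Vec ℕ n} → Binary c → Binary d → value q (c ⊕ d) ≡ N
                     → q ≡ 3 × c ≡ replicate n 1
    binary-⊕-value≡N {c} {d} bc bd eq = q≡3 , binary-midpoint bc bd (all-replicate n ≤-refl) (begin
      c ⊕ d                                 ≡⟨ c⊕d≡max ⟩
      replicate n (q ∸ 1)                   ≡⟨ cong (λ k → replicate n (k ∸ 1)) q≡3 ⟩
      replicate n 2                         ≡⟨ sym (zipWith-replicate _+_ 1 1) ⟩
      replicate n 1 ⊕ replicate n 1         ∎)
      where
      open ≡-Reasoning
      c⊕d≡max = value≡N⇒max (binary-⊕<q bc bd) eq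
      q≡3 = pred≤2⇒≡3 3≤q (constant-bound 1≤n (binary-⊕≤2 bc bd) c⊕d≡max)

    periodic⇒extremal-weights : ∀ {r t} {A : Vec ℕ n} → 0 < r → r < N → Periodic N f r
                              → Binary A → sum A ≡ t → t ∈ʷ S
                              → q ≡ 3 × ((t ≡ 0 × n ∈ʷ S) ⊎ (t ≡ n × 0 ∈ʷ S))
    periodic⇒extremal-weights {r} {A = A} 0<r r<N per bA refl wA
      with shifted-pair per r<N a<N (Equivalence.from (δ-binary bA) wA)
      where
      a<N : value q A < N
      a<N = value<N (binary⇒digits<q bA) λ A≡max → <⇒≱ (∸-monoˡ-≤ 1 3≤q) (constant-bound 1≤n bA A≡max)
    ... | X , Y , bX , bY , fX , vX , congruent =
      cases (%-≤-cases (value≤N (binary-⊕<q bX bY)) (value≤N (binary-⊕<q bA bA)) (begin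
        value q (X ⊕ Y) % N                ≡⟨ cong (_% N) (value-⊕ q X Y) ⟩
        (value q X + value q Y) % N        ≡⟨ congruent ⟩
        (value q A + value q A) % N        ≡⟨ cong (_% N) (sym (value-⊕ q A A)) ⟩
        value q (A ⊕ A) % N                ∎))
      where
      open ≡-Reasoning
      wX : sum X ∈ʷ S
      wX = Equivalence.to (δ-binary bX) fX
      cases : value q (X ⊕ Y) ≡ value q (A ⊕ A)
            ⊎ (value q (X ⊕ Y) ≡ 0 × value q (A ⊕ A) ≡ N)
            ⊎ (value q (X ⊕ Y) ≡ N × value q (A ⊕ A) ≡ 0)
            → q ≡ 3 × ((sum A ≡ 0 × n ∈ʷ S) ⊎ (sum A ≡ n × 0 ∈ʷ S))
      cases (inj₁ eq) = ⊥-elim (%-no-fixed-point 0<r r<N (trans (sym vX) (cong (value q) X≡A)))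
        where
        X≡A = binary-midpoint bX bY bA (value-injective (binary-⊕<q bX bY) (binary-⊕<q bA bA) eq)
      cases (inj₂ (inj₁ (XY≡0 , AA≡N))) =
        let q≡3 , A≡ones = binary-⊕-value≡N bA bA AA≡N in
        q≡3 , inj₂ (sum-ones A≡ones , subst (_∈ʷ S) (sum-zeros (binary-⊕-value≡0 bX bY XY≡0)) wX)
      cases (inj₂ (inj₂ (XY≡N , AA≡0))) =
        let q≡3 , X≡ones = binary-⊕-value≡N bX bY XY≡N in
        q≡3 , inj₁ (sum-zeros (binary-⊕-value≡0 bA bA AA≡0) , subst (_∈ʷ S) (sum-ones X≡ones) wX)

    periodic⇒S≡0n : ∀ {r} → 0 < r → r < N → Periodic N f r → Nonempty S
                  → q ≡ 3 × (∀ w → w ∈ S ⇔ (toℕ w ≡ 0 ⊎ toℕ w ≡ n))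
    periodic⇒S≡0n 0<r r<N per (s , s∈S) = proj₁ (extremal s s∈S) , λ w → mk⇔ (ends w) (back w)
      where
      extremal : ∀ w → w ∈ S → q ≡ 3 × ((toℕ w ≡ 0 × n ∈ʷ S) ⊎ (toℕ w ≡ n × 0 ∈ʷ S))
      extremal w w∈S =
        let A , bA , sA = binary-of-weight n (toℕ w) (toℕ≤pred[n] w) in
        periodic⇒extremal-weights 0<r r<N per bA sA (w , refl , w∈S)
      ends : ∀ w → w ∈ S → toℕ w ≡ 0 ⊎ toℕ w ≡ n
      ends w w∈S = Sum.map proj₁ proj₁ (proj₂ (extremal w w∈S))
      both : 0 ∈ʷ S × n ∈ʷ S
      both with proj₂ (extremal s s∈S)
      ... | inj₁ (s≡0 , n∈S) = (s , s≡0 , s∈S) , n∈S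
      ... | inj₂ (s≡n , 0∈S) = 0∈S , (s , s≡n , s∈S)
      back : ∀ w → toℕ w ≡ 0 ⊎ toℕ w ≡ n → w ∈ S
      back w (inj₁ w≡0) = Equivalence.to (toℕ∈ʷ⇔∈ w) (subst (_∈ʷ S) (sym w≡0) (proj₁ both))
      back w (inj₂ w≡n) = Equivalence.to (toℕ∈ʷ⇔∈ w) (subst (_∈ʷ S) (sym w≡n) (proj₂ both))

module Base2 (n M : ℕ) (S : Subset (suc n)) (value-max : value 2 (replicate n 1) ≡ suc M) where

  open Support ≤-refl S
  open Periodicity 2 n M ≤-refl S value-max

  private
    P : ℕ → Set
    P = _∈ʷ S

  weight-step : ∀ {r} {c d : Vec ℕ n} → Periodic N f r → Binary c → Binary d
              → value 2 c + r ≡ value 2 d → sum d < n → P (sum c) ⇔ P (sum d)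
  weight-step {r} {c} {d} per bc bd eq sum<n = begin
    P (sum c)             ≈⟨ δ-binary bc ⟨
    f (value 2 c)         ≈⟨ periodic-step f per (subst (_< N) (sym eq) value-d<N) ⟩
    f (value 2 c + r)     ≡⟨ cong f eq ⟩
    f (value 2 d)         ≈⟨ δ-binary bd ⟩
    P (sum d)             ∎
    where
    open import Relation.Binary.Reasoning.Setoid (⇔-setoid 0ℓ)
    value-d<N = value<N (binary⇒digits<q bd) (λ d≡ones → <⇒≢ sum<n (sum-ones d≡ones))

  shift-weight : ∀ {r} {R : Vec ℕ n} → Periodic N f r → Binary R → value 2 R ≡ r
               → ∀ t → t + sum R < n → P t ⇔ P (t + sum R)
  shift-weight {r} {R} per bR vR t lt with choose-disjoint t bR (<⇒≤ lt)
  ... | B , bBR , refl = subst (λ s → P (sum B) ⇔ P s) (sum-⊕ B R)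
          (weight-step per (binary-⊕ˡ B R bBR) bBR value-eq (subst (_< n) (sym (sum-⊕ B R)) lt))
    where
    value-eq : value 2 B + r ≡ value 2 (B ⊕ R)
    value-eq = trans (cong (value 2 B +_) (sym vR)) (sym (value-⊕ 2 B R))

  -- B ⊕ E and B ⊕ R′ differ by the period R (carry-value) and have weights t + 1 and t + sum R.
  carry-weight : ∀ {r} {E R R′ : Vec ℕ n} → Periodic N f r → Binary R → value 2 R ≡ r → Carry E R R′
               → ∀ t → t + sum R < n → P (suc t) ⇔ P (t + sum R)
  carry-weight {r} {E} {R} {R′} per bR vR c t lt with choose-disjoint t (carry-binary bR c) room
    where
    room : t + sum (E ⊕ R′) ≤ n
    room = subst (λ s → t + s ≤ n) (sym (trans (sum-⊕ E R′) (cong₂ _+_ (carry-unit c) (carry-sum c))))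
                 (subst (_≤ n) (sym (+-suc t (sum R))) lt)
  ... | B , bB⊕ , refl = subst₂ (λ u w → P u ⇔ P w) sum-BE sum-BR′
                           (weight-step per bBE bBR′ value-eq (subst (_< n) (sym sum-BR′) lt))
    where
    open ≡-Reasoning
    bBE = proj₁ (binary-split B E R′ bB⊕)
    bBR′ = proj₂ (binary-split B E R′ bB⊕)
    sum-BE : sum (B ⊕ E) ≡ suc (sum B)
    sum-BE = trans (sum-⊕ B E) (trans (cong (sum B +_) (carry-unit c)) (+-comm (sum B) 1))
    sum-BR′ : sum (B ⊕ R′) ≡ sum B + sum R
    sum-BR′ = trans (sum-⊕ B R′) (cong (sum B +_) (carry-sum c))
    value-eq : value 2 (B ⊕ E) + r ≡ value 2 (B ⊕ R′)
    value-eq = begin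
      value 2 (B ⊕ E) + r                     ≡⟨ cong₂ _+_ (value-⊕ 2 B E) (sym vR) ⟩
      value 2 B + value 2 E + value 2 R       ≡⟨ +-assoc (value 2 B) _ _ ⟩
      value 2 B + (value 2 E + value 2 R)     ≡⟨ cong (value 2 B +_) (carry-value c) ⟩
      value 2 B + value 2 R′                  ≡⟨ sym (value-⊕ 2 B R′) ⟩
      value 2 (B ⊕ R′)                        ∎

  complement-value : ∀ {r} {R : Vec ℕ n} → Binary R → value 2 R ≡ r → value 2 (complement R) ≡ N ∸ r
  complement-value {r} {R} bR vR = begin
    value 2 (complement R)                 ≡⟨ sym (m+n∸m≡n r _) ⟩
    r + value 2 (complement R) ∸ r         ≡⟨ cong (λ v → v + value 2 (complement R) ∸ r) (sym vR) ⟩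
    value 2 R + value 2 (complement R) ∸ r ≡⟨ cong (_∸ r) (sym (value-⊕ 2 R (complement R))) ⟩
    value 2 (R ⊕ complement R) ∸ r         ≡⟨ cong (λ c → value 2 c ∸ r) (binary-⊕-complement bR) ⟩
    value 2 (replicate n 1) ∸ r            ≡⟨ cong (_∸ r) value-max ⟩
    N ∸ r                                  ∎
    where open ≡-Reasoning

  -- Shifting by R₁ and carrying inside R₁ link the weights t and t + 1 for t < sum R₂;
  -- shifting by the complementary period R₂ links t and t + sum R₂.
  weights-linked : ∀ {r₁ r₂} {R₁ R₂ : Vec ℕ n} → Periodic N f r₁ → Periodic N f r₂
                 → Binary R₁ → Binary R₂ → value 2 R₁ ≡ r₁ → value 2 R₂ ≡ r₂
                 → sum R₁ + sum R₂ ≡ n → HasCarry R₁ → ∀ v → v < n → P v ⇔ P 0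
  weights-linked {R₁ = R₁} {R₂} per₁ per₂ b₁ b₂ v₁ v₂ total (E , R′ , c) =
    constant-below P 0<k₂ adjacent (shift-weight per₂ b₂ v₂)
    where
    k₁ = sum R₁
    k₂ = sum R₂
    k₁<n : k₁ < n
    k₁<n = subst (_≤ n) (trans (sum-⊕ E R′) (cong₂ _+_ (carry-unit c) (carry-sum c)))
                 (binary⇒sum≤length (carry-binary b₁ c))
    0<k₂ : 0 < k₂
    0<k₂ = +-cancelˡ-< k₁ 0 k₂ (subst₂ _<_ (sym (+-identityʳ k₁)) (sym total) k₁<n)
    adjacent : ∀ t → t < k₂ → P t ⇔ P (suc t)
    adjacent t t<k₂ = ⇔.trans (shift-weight per₁ b₁ v₁ t lt) (⇔.sym (carry-weight per₁ b₁ v₁ c t lt))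
      where
      lt : t + k₁ < n
      lt = subst (t + k₁ <_) (trans (+-comm k₂ k₁) total) (+-monoˡ-< k₁ t<k₂)

  periodic⇒constant-weights : 1 ≤ n → ∀ {r} → 0 < r → r < N → Periodic N f r → ∀ v → v < n → P v ⇔ P 0
  periodic⇒constant-weights 1≤n {r} 0<r r<N per with binary-expansion n r r<2^n
    where
    r<2^n : r < 2 ^ n
    r<2^n = <-trans r<N (subst (N <_) (trans (cong suc (sym value-max)) (suc-value-max 2 n (s≤s z≤n))) (n<1+n N))
  ... | R , bR , vR with constant-or-carry bR
  ... | inj₁ (d , R≡d) = ⊥-elim (constant R≡d (constant-bound 1≤n bR R≡d))
    where
    constant : ∀ {d} → R ≡ replicate n d → d ≤ 1 → ⊥
    constant refl z≤n       = <⇒≢ 0<r (trans (sym (value-zeros 2 n)) vR)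
    constant refl (s≤s z≤n) = <⇒≢ r<N (trans (sym vR) value-max)
  ... | inj₂ (inj₁ carry) = weights-linked per per̄ bR (binary-complement R) vR refl (complement-weight bR) carry
    where per̄ = subst (Periodic N f) (sym (complement-value bR vR)) (periodic-∸ f (<⇒≤ r<N) per)
  ... | inj₂ (inj₂ carry) = weights-linked per̄ per (binary-complement R) bR refl vR
                              (trans (+-comm _ (sum R)) (complement-weight bR)) carry
    where per̄ = subst (Periodic N f) (sym (complement-value bR vR)) (periodic-∸ f (<⇒≤ r<N) per)

  periodic⇒S≡below-n : 1 ≤ n → ∀ {r} → 0 < r → r < N → Periodic N f r → fromℕ n ∉ S → Nonempty S
                     → ∀ w → w ∈ S ⇔ toℕ w < n
  periodic⇒S≡below-n 1≤n 0<r r<N per n∉S (s , s∈S) w = mk⇔ (below w) λ w<n →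
    Equivalence.to (toℕ∈ʷ⇔∈ w) (Equivalence.from (constant (toℕ w) w<n) P0)
    where
    constant = periodic⇒constant-weights 1≤n 0<r r<N per
    below : ∀ w → w ∈ S → toℕ w < n
    below w w∈S = ≤∧≢⇒< (toℕ≤pred[n] w)
      λ w≡n → n∉S (subst (_∈ S) (toℕ-injective (trans w≡n (sym (toℕ-fromℕ n)))) w∈S)
    P0 : P 0
    P0 = Equivalence.to (constant (toℕ s) (below s s∈S)) (s , refl , s∈S)

m≤m^k : ∀ {m k} → 0 < m → 1 ≤ k → m ≤ m ^ k
m≤m^k {m} {k} 0<m 1≤k = subst (_≤ m ^ k) (*-identityʳ m) (^-monoʳ-≤ m {{>-nonZero 0<m}} 1≤k)

2≤prime-power : ∀ {q} → IsPrimePower q → 2 ≤ q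
2≤prime-power (p , k , p-prime , 0<k , refl) = ≤-trans 2≤p (m≤m^k (≤-trans (s≤s z≤n) 2≤p) 0<k)
  where 2≤p = nonTrivial⇒n>1 p {{prime⇒nonTrivial p-prime}}

lemma4p2 : (q n : ℕ) → IsPrimePower q → 1 ≤ n → (S : Subset (suc n)) → Nonempty S
    → (q ≡ 2 → (fromℕ n ∉ S) × ¬ (∀ (w : Fin (suc n)) → (w ∈ S) ⇔ (toℕ w < n)))
    → (q ≡ 3 → ¬ (∀ (w : Fin (suc n)) → (w ∈ S) ⇔ ((toℕ w ≡ 0) ⊎ (toℕ w ≡ n))))
    → MaxLeastPeriod (q ^ n ∸ 1) (δ q n S)
lemma4p2 q n pp 1≤n S ne h2 h3 with 2≤prime-power pp | q ^ n ∸ 1 in q^n∸1≡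
... | 2≤q | zero  = ⊥-elim (<⇒≱ (≤-trans 2≤q (m≤m^k (≤-trans (s≤s z≤n) 2≤q) 1≤n)) (m∸n≡0⇒m≤n q^n∸1≡))
... | 2≤q | suc M = s≤s z≤n , periodic-self f , no-shorter-period
  where
  value-max : value q (replicate n (q ∸ 1)) ≡ suc M
  value-max = trans (cong (_∸ 1) (suc-value-max q n (≤-trans (s≤s z≤n) 2≤q))) q^n∸1≡
  open Periodicity q n M 2≤q S value-max
  no-shorter-period : ∀ r → 0 < r → r < N → ¬ Periodic N f r
  no-shorter-period r 0<r r<N per with m≤n⇒m<n∨m≡n 2≤q
  ... | inj₁ 3≤q  = let q≡3 , S≡0n = periodic⇒S≡0n 3≤q 1≤n 0<r r<N per ne in h3 q≡3 S≡0n
  ... | inj₂ refl = proj₂ (h2 refl)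
                      (Base2.periodic⇒S≡below-n n M S value-max 1≤n 0<r r<N per (proj₁ (h2 refl)) ne)
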